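{- For all $n\geq0$, the number of $123$-avoiding Jacobi permutations $\pi\in\mathfrak{S}_n$ whose inverse $\pi^{ -1}$ is also Jacobi equals $s_n$, where $s_0=1$ and $s_{n+1}=s_n+\sum_{k=1}^{n-1}s_ks_{n-1-k}$ for all $n\geq0$.
   Context: A permutation of a finite set $S$ of positive integers is a word in which each element of $S$ appears exactly once; $\mathfrak{S}_n$ is the set of permutations of $\{1,\dots,n\}$ (the empty permutation is its own inverse). For a permutation $\pi$ and a letter $x$ of $\pi$, $\rho_\pi(x)$ is the maximal consecutive subword of $\pi$ consisting of the letters immediately to the right of $x$ that are all larger than $x$. $\pi$ is Jacobi if $|\rho_\pi(x)|$ is even for all letters $x$. A permutation $\pi$ avoids a pattern $\sigma$ if no subword of $\pi$ has standardization (relative order) $\sigma$. $\pi^{ -1}$ denotes the inverse of $\pi$ in the symmetric group $\mathfrak{S}_n$. -}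

module Defs where

open import Data.Nat using (ℕ; zero; suc; _<_; _<ᵇ_; _≡ᵇ_; _∸_; _+_; _*_)
open import Data.Nat.Divisibility using (_∣_)
open import Data.List using (List; []; _∷_; length; map; upTo; takeWhileᵇ)
open import Data.Nat.ListAction using (sum)
open import Data.List.Relation.Binary.Permutation.Propositional using (_↭_)
open import Data.List.Relation.Binary.Sublist.Propositional using (_⊆_)
open import Data.Product using (_×_; ∃-syntax)
open import Data.Unit using (⊤)
open import Data.Bool using (if_then_else_)
open import Relation.Nullary using (¬_)

[1‥_] : ℕ → List ℕ
[1‥ n ] = map suc (upTo n)

IsPerm : ℕ → List ℕ → Set
IsPerm n w = w ↭ [1‥ n ]

ρ-length : ℕ → List ℕ → ℕ
ρ-length x xs = length (takeWhileᵇ (x <ᵇ_) xs)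

Jacobi : List ℕ → Set
Jacobi []       = ⊤
Jacobi (x ∷ xs) = (2 ∣ ρ-length x xs) × Jacobi xs

-- 1-based position of the (first occurrence of the) letter i in w
pos : ℕ → List ℕ → ℕ
pos i []       = 0
pos i (x ∷ xs) = if i ≡ᵇ x then 1 else suc (pos i xs)

inverse : ℕ → List ℕ → List ℕ
inverse n w = map (λ i → pos i w) [1‥ n ]

Avoids123 : List ℕ → Set
Avoids123 w = ¬ (∃[ a ] ∃[ b ] ∃[ c ] ((a ∷ b ∷ c ∷ []) ⊆ w × a < b × b < c))

Counted : ℕ → List ℕ → Set
Counted n w = IsPerm n w × Avoids123 w × Jacobi w × Jacobi (inverse n w)

convSum : (ℕ → ℕ) → ℕ → ℕ
convSum s n = sum (map (λ k → s k * s (n ∸ 1 ∸ k)) [1‥ n ∸ 1 ])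

{-# OPTIONS --safe #-}
module Submission where

-- Let t(n) be the number of counted permutations of size n and write N = n + 2. A counted
-- permutation w of size N either starts with N, and then the rest is counted of size n + 1, or it
-- contains the factor N (n + 1) preceded by a nonempty decreasing word A, and deleting that factor
-- leaves a counted permutation of size n. Indeed, the inverse of w ends with pos(n + 1) pos(N),
-- which must be a descent, so n + 1 comes after N; the letter right after N exceeds some letter
-- before N (Jacobi condition at the left neighbour of N), so by 123-avoidance it is n + 1; and an
-- ascent inside A would form a 123 with N. Conversely both constructions preserve all four
-- conditions: ρ-lengths change by 0 or 2, and the inverse changes by an order-preserving
-- relabelling followed by the tail 1, resp. (|A| + 2) (|A| + 1).
--
-- For a counted τ of size n the admissible |A| are 1, …, d(τ), the length of the decreasing prefix
-- of τ, so t(n + 2) = t(n + 1) + Σ_τ d(τ). Prepending N raises d by one and inserting after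
-- position j gives d = j, so the multisets D(n) = {d(τ)} satisfy
-- D(n + 2) = (D(n + 1) + 1) ⊎ ⨄_{d ∈ D(n)} {1, …, d}. Induction on n, for an arbitrary weight f,
-- gives Σ_{d ∈ D(n)} Σ_{i ≤ d} f(i) = Σ_{k = 1}^{n} t(n - k) Σ_{d ∈ D(k)} f(d), and f = 1 turns
-- the recurrence for t into the one for s.

open import Defs
open import Algebra.Properties.CommutativeSemigroup using (interchange)
open import Data.Bool using (true; false; if_then_else_)
open import Data.Empty using (⊥)
open import Data.List using (List; []; _∷_; _++_; [_]; length; map; take; drop; upTo; applyUpTo; concat; concatMap)
open import Data.List.Properties
  using (map-++; map-∘; map-cong; map-cong-local; map-id-local; map-upTo; map-concatMap; concatMap-map; length-map;
         length-take; upTo-∷ʳ; ++-assoc; ∷-injective; ∷-injectiveˡ; ∷-injectiveʳ; take++drop≡id)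
open import Data.List.Membership.Propositional using (_∈_; _∉_; find; lose)
open import Data.List.Membership.Propositional.Properties
  using (∈-map⁺; ∈-map⁻; ∈-upTo⁺; ∈-upTo⁻; ∈-++⁺ˡ; ∈-++⁺ʳ; ∈-++⁻; ∈-∃++; ∈-concatMap⁺; ∈-concatMap⁻; map∷⁻)
open import Data.List.Relation.Binary.Disjoint.Propositional using (Disjoint)
open import Data.List.Relation.Binary.Permutation.Propositional
  using (_↭_; ↭-refl; ↭-sym; ↭-trans; ↭-prep; ↭-reflexive; ↭⇒↭ₛ)
open import Data.List.Relation.Binary.Permutation.Propositional.Properties
  using (∈-resp-↭; drop-∷; shift; ∷↭∷ʳ; ↭-empty-inv; ↭-singleton-inv)
open import Data.List.Relation.Binary.Sublist.Propositional using (_⊆_; _∷_; _∷ʳ_; ⊆-refl; ⊆-trans; minimum; to∈; from∈)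
open import Data.List.Relation.Binary.Sublist.Propositional.Properties using (++⁺; ++⁺ˡ)
open import Data.List.Relation.Unary.All as All using (All; []; _∷_)
import Data.List.Relation.Unary.All.Properties as All
open import Data.List.Relation.Unary.AllPairs using ([]; _∷_)
open import Data.List.Relation.Unary.Any as Any using (here; there)
open import Data.List.Relation.Unary.Linked as Linked using (Linked; []; [-]; _∷_)
open import Data.List.Relation.Unary.Linked.Properties using (Linked⇒All)
open import Data.List.Relation.Unary.Unique.Propositional using (Unique)
open import Data.List.Relation.Unary.Unique.Propositional.Properties as Unique using (upTo⁺)
open import Data.Nat using (ℕ; zero; suc; _+_; _*_; _∸_; _<_; _≤_; _>_; _≮_; _<ᵇ_; _≤ᵇ_; _≡ᵇ_; z≤n; s≤s; z<s; s<s)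
open import Data.Nat.Divisibility using (_∣_; _∣0; ∣-refl; ∣1⇒≡1; ∣m∣n⇒∣m+n; ∣m+n∣m⇒∣n)
open import Data.Nat.Induction using (<-rec)
open import Data.Nat.ListAction using (sum)
open import Data.Nat.ListAction.Properties using (sum-++)
open import Data.Nat.Properties
open import Data.Product using (_×_; _,_; proj₁; proj₂; ∃-syntax)
open import Data.Sum using (_⊎_; inj₁; inj₂)
open import Data.Unit using (tt)
open import Function using (id; _∘_)
open import Function.Bundles using (_⇔_; mk⇔; Equivalence)
open import Relation.Binary.Core using (_Preserves_⟶_)
open import Relation.Binary.PropositionalEquality
  using (_≡_; _≢_; refl; sym; trans; cong; cong₂; subst; subst₂; setoid; module ≡-Reasoning)
open import Relation.Nullary using (¬_; yes; no; contradiction)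
open import Relation.Nullary.Reflects using (ofʸ; ofⁿ)

open import Data.List.Membership.DecPropositional _≟_ using (_∈?_)
open import Data.List.Relation.Binary.Permutation.Setoid.Properties (setoid ℕ) using (Unique-resp-↭)
open ≡-Reasoning

private variable
  a b c i j n p q x y : ℕ
  A B σ xs ys : List ℕ

++-∷-cancel-∉ : ∀ {X : Set} {x : X} A C {B D} → x ∉ A → x ∉ C → A ++ x ∷ B ≡ C ++ x ∷ D → A ≡ C × B ≡ D
++-∷-cancel-∉ []      []      _   _   e = refl , ∷-injectiveʳ e
++-∷-cancel-∉ []      (c ∷ C) _   x∉C e = contradiction (here (∷-injectiveˡ e)) x∉C
++-∷-cancel-∉ (a ∷ A) []      x∉A _   e = contradiction (here (sym (∷-injectiveˡ e))) x∉A
++-∷-cancel-∉ (a ∷ A) (c ∷ C) x∉A x∉C e with ∷-injective e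
... | refl , e′ with ++-∷-cancel-∉ A C (x∉A ∘ there) (x∉C ∘ there) e′
...   | refl , B≡D = refl , B≡D

length-take-≤ : ∀ k (xs : List ℕ) → k ≤ length xs → length (take k xs) ≡ k
length-take-≤ k xs k≤ = trans (length-take k xs) (m≤n⇒m⊓n≡m k≤)

∷⊆-++⁻ʳ : ∀ A → x ∉ A → x ∷ xs ⊆ A ++ ys → x ∷ xs ⊆ ys
∷⊆-++⁻ʳ []      _   x⊆         = x⊆
∷⊆-++⁻ʳ (a ∷ A) x∉A (_ ∷ʳ x⊆)  = ∷⊆-++⁻ʳ A (x∉A ∘ there) x⊆
∷⊆-++⁻ʳ (a ∷ A) x∉A (refl ∷ _) = contradiction (here refl) x∉A

Unique-∉ˡ : ∀ A → Unique (A ++ x ∷ B) → x ∉ A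
Unique-∉ˡ (a ∷ A) (a∉ ∷ _) (here refl)  = All.lookup a∉ (∈-++⁺ʳ A (here refl)) refl
Unique-∉ˡ (a ∷ A) (_ ∷ u)  (there x∈A) = Unique-∉ˡ A u x∈A

Unique-∉ʳ : ∀ A → Unique (A ++ x ∷ B) → x ∉ B
Unique-∉ʳ []      (x∉ ∷ _) x∈B = All.lookup x∉ x∈B refl
Unique-∉ʳ (a ∷ A) (_ ∷ u)      = Unique-∉ʳ A u

Unique-map⁺-∈ : ∀ {X Y : Set} {f : X → Y} {xs} → (∀ {x y} → x ∈ xs → y ∈ xs → f x ≡ f y → x ≡ y) →
                Unique xs → Unique (map f xs)
Unique-map⁺-∈                       _   []       = []
Unique-map⁺-∈ {f = f} {xs = x ∷ xs} inj (x∉ ∷ u) =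
  All.map⁺ (All.tabulate λ y∈ fx≡fy → All.lookup x∉ y∈ (inj (here refl) (there y∈) fx≡fy)) ∷
  Unique-map⁺-∈ (λ x∈ y∈ → inj (there x∈) (there y∈)) u

Unique-concatMap⁺ : ∀ {X Y : Set} (f : X → List Y) {xs} → Unique xs → (∀ {x} → x ∈ xs → Unique (f x)) →
                    (∀ {x y v} → x ∈ xs → y ∈ xs → v ∈ f x → v ∈ f y → x ≡ y) → Unique (concatMap f xs)
Unique-concatMap⁺ f {[]}     _        _      _      = []
Unique-concatMap⁺ f {x ∷ xs} (x∉ ∷ u) unique shared =
  Unique.++⁺ (unique (here refl)) (Unique-concatMap⁺ f u (unique ∘ there) (λ x∈ y∈ → shared (there x∈) (there y∈))) disjoint
  where
  disjoint : Disjoint (f x) (concatMap f xs)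
  disjoint (v∈fx , v∈rest) with find (∈-concatMap⁻ f v∈rest)
  ... | y , y∈ , v∈fy = All.lookup x∉ y∈ (shared (here refl) (there y∈) v∈fx v∈fy)

sumBelow : ℕ → (ℕ → ℕ) → ℕ
sumBelow zero    g = 0
sumBelow (suc n) g = g 0 + sumBelow n (g ∘ suc)

sumBelow-cong : ∀ n {g h : ℕ → ℕ} → (∀ {i} → i < n → g i ≡ h i) → sumBelow n g ≡ sumBelow n h
sumBelow-cong zero    _   = refl
sumBelow-cong (suc n) g≡h = cong₂ _+_ (g≡h z<s) (sumBelow-cong n (g≡h ∘ s<s))

sumBelow-+ : ∀ n (g h : ℕ → ℕ) → sumBelow n (λ i → g i + h i) ≡ sumBelow n g + sumBelow n h
sumBelow-+ zero    g h = refl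
sumBelow-+ (suc n) g h =
  trans (cong (g 0 + h 0 +_) (sumBelow-+ n (g ∘ suc) (h ∘ suc))) (interchange +-commutativeSemigroup (g 0) (h 0) _ _)

sum-map-applyUpTo : ∀ (f g : ℕ → ℕ) n → sum (map f (applyUpTo g n)) ≡ sumBelow n (f ∘ g)
sum-map-applyUpTo f g zero    = refl
sum-map-applyUpTo f g (suc n) = cong (f (g 0) +_) (sum-map-applyUpTo f (g ∘ suc) n)

sum-map-[1‥] : ∀ (f : ℕ → ℕ) n → sum (map f [1‥ n ]) ≡ sumBelow n (f ∘ suc)
sum-map-[1‥] f n = trans (cong (sum ∘ map f) (map-upTo suc n)) (sum-map-applyUpTo f suc n)

module _ {X : Set} where

  sum-map-++ : ∀ (f : X → ℕ) xs ys → sum (map f (xs ++ ys)) ≡ sum (map f xs) + sum (map f ys)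
  sum-map-++ f xs ys = trans (cong sum (map-++ f xs ys)) (sum-++ (map f xs) (map f ys))

  sum-map-+ : ∀ (f g : X → ℕ) xs → sum (map (λ x → f x + g x) xs) ≡ sum (map f xs) + sum (map g xs)
  sum-map-+ f g []       = refl
  sum-map-+ f g (x ∷ xs) =
    trans (cong (f x + g x +_) (sum-map-+ f g xs)) (interchange +-commutativeSemigroup (f x) (g x) _ _)

  sum-map-const : ∀ c (xs : List X) → sum (map (λ _ → c) xs) ≡ c * length xs
  sum-map-const c []       = sym (*-zeroʳ c)
  sum-map-const c (x ∷ xs) = trans (cong (c +_) (sum-map-const c xs)) (sym (*-suc c (length xs)))


sum-map-concatMap : ∀ {X : Set} (f : ℕ → ℕ) (g : X → List ℕ) xs →
                    sum (map f (concatMap g xs)) ≡ sum (map (λ x → sum (map f (g x))) xs)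
sum-map-concatMap f g []       = refl
sum-map-concatMap f g (x ∷ xs) =
  trans (sum-map-++ f (g x) (concatMap g xs)) (cong (sum (map f (g x)) +_) (sum-map-concatMap f g xs))

-- Jacobi words

_≡or2+_ : ℕ → ℕ → Set
a ≡or2+ b = a ≡ b ⊎ a ≡ 2 + b

≡or2+-suc : a ≡or2+ b → suc a ≡or2+ suc b
≡or2+-suc (inj₁ refl) = inj₁ refl
≡or2+-suc (inj₂ refl) = inj₂ refl

even-resp-≡or2+ : a ≡or2+ b → 2 ∣ a ⇔ 2 ∣ b
even-resp-≡or2+ (inj₁ refl) = mk⇔ id id
even-resp-≡or2+ (inj₂ refl) = mk⇔ (λ 2∣2+b → ∣m+n∣m⇒∣n 2∣2+b ∣-refl) (∣m∣n⇒∣m+n ∣-refl)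

¬2∣1 : ¬ 2 ∣ 1
¬2∣1 2∣1 with ∣1⇒≡1 2∣1
... | ()

ρ-length-< : ∀ ys → x < y → ρ-length x (y ∷ ys) ≡ suc (ρ-length x ys)
ρ-length-< {x} {y} ys x<y with x <ᵇ y | <ᵇ-reflects-< x y
... | true  | _       = refl
... | false | ofⁿ x≮y = contradiction x<y x≮y

ρ-length-≮ : ∀ ys → x ≮ y → ρ-length x (y ∷ ys) ≡ 0
ρ-length-≮ {x} {y} ys x≮y with x <ᵇ y | <ᵇ-reflects-< x y
... | false | _       = refl
... | true  | ofʸ x<y = contradiction x<y x≮y

ρ-length-≤ : All (_≤ x) ys → ρ-length x ys ≡ 0
ρ-length-≤ []        = refl
ρ-length-≤ (y≤x ∷ _) = ρ-length-≮ _ (≤⇒≯ y≤x)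

Jacobi-∷ : ρ-length x xs ≡ 0 → Jacobi xs → Jacobi (x ∷ xs)
Jacobi-∷ ρ≡0 jxs = subst (2 ∣_) (sym ρ≡0) (2 ∣0) , jxs

Jacobi-++⁻ʳ : ∀ xs → Jacobi (xs ++ ys) → Jacobi ys
Jacobi-++⁻ʳ []       jys       = jys
Jacobi-++⁻ʳ (x ∷ xs) (_ , jxs) = Jacobi-++⁻ʳ xs jxs

Jacobi-peak-ascent : ∀ x A → All (_< p) (x ∷ A) → Jacobi (x ∷ A ++ p ∷ y ∷ ys) → ∃[ z ] z ∈ x ∷ A × z < y
Jacobi-peak-ascent {p} {y} {ys} x [] (x<p ∷ _) (ρx , _) with x <? y
... | yes x<y = x , here refl , x<y
... | no  x≮y = contradiction (subst (2 ∣_) (trans (ρ-length-< (y ∷ ys) x<p) (cong suc (ρ-length-≮ ys x≮y))) ρx) ¬2∣1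
Jacobi-peak-ascent x (a ∷ A) (_ ∷ A<p) (_ , j) with Jacobi-peak-ascent a A A<p j
... | z , z∈ , z<y = z , there z∈ , z<y

module _ {p q : ℕ} (q<p : q < p) where

  ρ-length-addPair : x < q → ∀ A → ρ-length x (A ++ p ∷ q ∷ B) ≡or2+ ρ-length x (A ++ B)
  ρ-length-addPair {x} {B} x<q [] =
    inj₂ (trans (ρ-length-< (q ∷ B) (<-trans x<q q<p)) (cong suc (ρ-length-< B x<q)))
  ρ-length-addPair {x} {B} x<q (a ∷ A) with x <? a
  ... | yes x<a = subst₂ _≡or2+_ (sym (ρ-length-< _ x<a)) (sym (ρ-length-< _ x<a)) (≡or2+-suc (ρ-length-addPair x<q A))
  ... | no  x≮a = subst₂ _≡or2+_ (sym (ρ-length-≮ _ x≮a)) (sym (ρ-length-≮ _ x≮a)) (inj₁ refl)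

  Jacobi-dropPair : All (_< q) A → Jacobi (A ++ p ∷ q ∷ B) → Jacobi (A ++ B)
  Jacobi-dropPair []                  (_ , _ , jB) = jB
  Jacobi-dropPair {a ∷ A} (a<q ∷ A<q) (ρa , j)     =
    Equivalence.to (even-resp-≡or2+ (ρ-length-addPair a<q A)) ρa , Jacobi-dropPair A<q j

  Jacobi-addPair : All (_< q) A → All (_≤ q) B → Jacobi (A ++ B) → Jacobi (A ++ p ∷ q ∷ B)
  Jacobi-addPair []                  B≤q jB       = Jacobi-∷ (ρ-length-≮ _ (<⇒≯ q<p)) (Jacobi-∷ (ρ-length-≤ B≤q) jB)
  Jacobi-addPair {a ∷ A} (a<q ∷ A<q) B≤q (ρa , j) =
    Equivalence.from (even-resp-≡or2+ (ρ-length-addPair a<q A)) ρa , Jacobi-addPair A<q B≤q j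

module _ {g : ℕ → ℕ} (g-mono : g Preserves _<_ ⟶ _<_) (T : List ℕ) (ρ-tail : ∀ x → ρ-length (g x) T ≡or2+ 0) where

  private
    ≮-relabel : x ≮ y → g x ≮ g y
    ≮-relabel x≮y gx<gy with m≤n⇒m<n∨m≡n (≮⇒≥ x≮y)
    ... | inj₁ y<x  = <-asym gx<gy (g-mono y<x)
    ... | inj₂ refl = <-irrefl refl gx<gy

  ρ-length-relabel : ∀ xs → ρ-length (g x) (map g xs ++ T) ≡or2+ ρ-length x xs
  ρ-length-relabel []             = ρ-tail _
  ρ-length-relabel {x} (y ∷ xs) with x <? y
  ... | yes x<y = subst₂ _≡or2+_ (sym (ρ-length-< _ (g-mono x<y))) (sym (ρ-length-< xs x<y))
                    (≡or2+-suc (ρ-length-relabel xs))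
  ... | no  x≮y = subst₂ _≡or2+_ (sym (ρ-length-≮ _ (≮-relabel x≮y))) (sym (ρ-length-≮ xs x≮y))
                    (inj₁ refl)

  Jacobi-relabel⁻ : ∀ xs → Jacobi (map g xs ++ T) → Jacobi xs
  Jacobi-relabel⁻ []       _        = tt
  Jacobi-relabel⁻ (x ∷ xs) (ρx , j) =
    Equivalence.to (even-resp-≡or2+ (ρ-length-relabel xs)) ρx , Jacobi-relabel⁻ xs j

  Jacobi-relabel⁺ : Jacobi T → ∀ xs → Jacobi xs → Jacobi (map g xs ++ T)
  Jacobi-relabel⁺ jT []       _        = jT
  Jacobi-relabel⁺ jT (x ∷ xs) (ρx , j) =
    Equivalence.from (even-resp-≡or2+ (ρ-length-relabel xs)) ρx , Jacobi-relabel⁺ jT xs j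

All≤⇒∉ : All (_≤ n) A → n < x → x ∉ A
All≤⇒∉ A≤n n<x x∈A = <⇒≱ n<x (All.lookup A≤n x∈A)

∈-[1‥]⁻ : i ∈ [1‥ n ] → 0 < i × i ≤ n
∈-[1‥]⁻ i∈ with ∈-map⁻ suc i∈
... | _ , k∈ , refl = z<s , ∈-upTo⁻ k∈

∈-[1‥]⁺ : 0 < i → i ≤ n → i ∈ [1‥ n ]
∈-[1‥]⁺ {suc i} z<s i<n = ∈-map⁺ suc (∈-upTo⁺ i<n)

[1‥]-∷ʳ : ∀ n → [1‥ suc n ] ≡ [1‥ n ] ++ [ suc n ]
[1‥]-∷ʳ n = trans (cong (map suc) (sym (upTo-∷ʳ n))) (map-++ suc (upTo n) [ n ])

[1‥suc]↭ : ∀ n → [1‥ suc n ] ↭ suc n ∷ [1‥ n ]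
[1‥suc]↭ n = ↭-trans (↭-reflexive ([1‥]-∷ʳ n)) (↭-sym (∷↭∷ʳ (suc n) [1‥ n ]))

Unique-[1‥] : ∀ n → Unique [1‥ n ]
Unique-[1‥] n = Unique.map⁺ suc-injective (upTo⁺ n)

IsPerm-bounds : IsPerm n σ → x ∈ σ → 0 < x × x ≤ n
IsPerm-bounds σ↭ x∈σ = ∈-[1‥]⁻ (∈-resp-↭ σ↭ x∈σ)

IsPerm-≤ : IsPerm n σ → All (_≤ n) σ
IsPerm-≤ σ↭ = All.tabulate (proj₂ ∘ IsPerm-bounds σ↭)

IsPerm-∈ : IsPerm n σ → 0 < i → i ≤ n → i ∈ σ
IsPerm-∈ σ↭ 0<i i≤n = ∈-resp-↭ (↭-sym σ↭) (∈-[1‥]⁺ 0<i i≤n)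

IsPerm⇒Unique : IsPerm n σ → Unique σ
IsPerm⇒Unique {n} σ↭ = Unique-resp-↭ (↭⇒↭ₛ (↭-sym σ↭)) (Unique-[1‥] n)

IsPerm-before-max : ∀ A → IsPerm n (A ++ n ∷ B) → All (_< n) A
IsPerm-before-max A w↭ = All.tabulate λ {a} a∈A →
  ≤∧≢⇒< (proj₂ (IsPerm-bounds w↭ (∈-++⁺ˡ a∈A))) (λ a≡n → Unique-∉ˡ A (IsPerm⇒Unique w↭) (subst (_∈ A) a≡n a∈A))

IsPerm-∷ : IsPerm n σ ⇔ IsPerm (suc n) (suc n ∷ σ)
IsPerm-∷ {n} = mk⇔ (λ σ↭ → ↭-trans (↭-prep _ σ↭) (↭-sym ([1‥suc]↭ n)))
                   (λ w↭ → drop-∷ (↭-trans w↭ ([1‥suc]↭ n)))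

IsPerm-addPair : ∀ A → IsPerm n (A ++ B) ⇔ IsPerm (2 + n) (A ++ 2 + n ∷ 1 + n ∷ B)
IsPerm-addPair {n} {B} A = mk⇔
  (λ τ↭ → ↭-trans pair-to-front (↭-trans (↭-prep _ (↭-prep _ τ↭)) (↭-sym top-two)))
  (λ w↭ → drop-∷ (drop-∷ (↭-trans (↭-sym pair-to-front) (↭-trans w↭ top-two))))
  where
  pair-to-front : A ++ 2 + n ∷ 1 + n ∷ B ↭ 2 + n ∷ 1 + n ∷ A ++ B
  pair-to-front = ↭-trans (shift _ A _) (↭-prep _ (shift _ A B))
  top-two : [1‥ 2 + n ] ↭ 2 + n ∷ 1 + n ∷ [1‥ n ]
  top-two = ↭-trans ([1‥suc]↭ (suc n)) (↭-prep _ ([1‥suc]↭ n))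

-- Positions and inverses

pos-here : ∀ xs → i ≡ x → pos i (x ∷ xs) ≡ 1
pos-here {i} {x} _ i≡x with i ≡ᵇ x | ≡⇒≡ᵇ i x i≡x
... | true | _ = refl

pos-there : ∀ xs → i ≢ x → pos i (x ∷ xs) ≡ suc (pos i xs)
pos-there {i} {x} _ i≢x with i ≡ᵇ x | ≡ᵇ⇒≡ i x
... | false | _   = refl
... | true  | i≡x = contradiction (i≡x tt) i≢x

pos-∈-positive : ∀ A → i ∈ A → 0 < pos i A
pos-∈-positive {i} (a ∷ A) _ with i ≟ a
... | yes i≡a = subst (0 <_) (sym (pos-here A i≡a)) z<s
... | no  i≢a = subst (0 <_) (sym (pos-there A i≢a)) z<s

pos-≤-length : ∀ A → i ∈ A → pos i A ≤ length A
pos-≤-length {i} (a ∷ A) i∈ with i ≟ a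
... | yes i≡a = subst (_≤ length (a ∷ A)) (sym (pos-here A i≡a)) (s≤s z≤n)
... | no  i≢a = subst (_≤ length (a ∷ A)) (sym (pos-there A i≢a)) (s≤s (pos-≤-length A (Any.tail i≢a i∈)))

pos-++-∉ : ∀ A ys → i ∉ A → pos i (A ++ ys) ≡ length A + pos i ys
pos-++-∉ []      ys i∉A = refl
pos-++-∉ (a ∷ A) ys i∉A = trans (pos-there (A ++ ys) (i∉A ∘ here)) (cong suc (pos-++-∉ A ys (i∉A ∘ there)))

pos-++-∈ : ∀ A ys → i ∈ A → pos i (A ++ ys) ≡ pos i A
pos-++-∈ {i} (a ∷ A) ys i∈ with i ≟ a
... | yes i≡a = trans (pos-here (A ++ ys) i≡a) (sym (pos-here A i≡a))
... | no  i≢a = trans (pos-there (A ++ ys) i≢a) (trans (cong suc (pos-++-∈ A ys (Any.tail i≢a i∈))) (sym (pos-there A i≢a)))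

inverse-suc : ∀ n w → inverse (suc n) w ≡ inverse n w ++ [ pos (suc n) w ]
inverse-suc n w = trans (cong (map (λ i → pos i w)) ([1‥]-∷ʳ n)) (map-++ (λ i → pos i w) [1‥ n ] [ suc n ])

inverse-suc-suc : ∀ n w → inverse (2 + n) w ≡ inverse n w ++ pos (1 + n) w ∷ pos (2 + n) w ∷ []
inverse-suc-suc n w = begin
  inverse (2 + n) w                                       ≡⟨ inverse-suc (suc n) w ⟩
  inverse (1 + n) w ++ [ pos (2 + n) w ]                  ≡⟨ cong (_++ [ pos (2 + n) w ]) (inverse-suc n w) ⟩
  (inverse n w ++ [ pos (1 + n) w ]) ++ [ pos (2 + n) w ] ≡⟨ ++-assoc (inverse n w) _ _ ⟩
  inverse n w ++ pos (1 + n) w ∷ pos (2 + n) w ∷ []       ∎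

Jacobi-inverse-last-two : ∀ n w → Jacobi (inverse (2 + n) w) → pos (1 + n) w ≮ pos (2 + n) w
Jacobi-inverse-last-two n w jw⁻¹ pos<pos = ¬2∣1 (subst (2 ∣_) (ρ-length-< [] pos<pos) ρ-last-two)
  where
  ρ-last-two : 2 ∣ ρ-length (pos (1 + n) w) [ pos (2 + n) w ]
  ρ-last-two = proj₁ (Jacobi-++⁻ʳ (inverse n w) (subst Jacobi (inverse-suc-suc n w) jw⁻¹))

inverse-prepend : ∀ n σ → inverse (suc n) (suc n ∷ σ) ≡ map suc (inverse n σ) ++ [ 1 ]
inverse-prepend n σ = begin
  inverse (suc n) (suc n ∷ σ)                                          ≡⟨ inverse-suc n (suc n ∷ σ) ⟩
  map (λ i → pos i (suc n ∷ σ)) [1‥ n ] ++ [ pos (suc n) (suc n ∷ σ) ] ≡⟨ cong₂ (λ u v → u ++ [ v ])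
                                                                              (map-cong-local (All.tabulate pos-below))
                                                                              (pos-here σ refl) ⟩
  map (suc ∘ λ i → pos i σ) [1‥ n ] ++ [ 1 ]                           ≡⟨ cong (_++ [ 1 ]) (map-∘ [1‥ n ]) ⟩
  map suc (inverse n σ) ++ [ 1 ]                                       ∎
  where
  pos-below : i ∈ [1‥ n ] → pos i (suc n ∷ σ) ≡ suc (pos i σ)
  pos-below i∈ = pos-there σ (<⇒≢ (s≤s (proj₂ (∈-[1‥]⁻ i∈))))

-- Renumbers a position of A ++ B as a position of A ++ p ∷ q ∷ B, where j = length A.
skipTwo : ℕ → ℕ → ℕ
skipTwo j a = if a ≤ᵇ j then a else 2 + a

skipTwo-≤ : a ≤ j → skipTwo j a ≡ a
skipTwo-≤ {a} {j} a≤j with a ≤ᵇ j | ≤ᵇ-reflects-≤ a j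
... | true  | _       = refl
... | false | ofⁿ a≰j = contradiction a≤j a≰j

skipTwo-> : j < a → skipTwo j a ≡ 2 + a
skipTwo-> {j} {a} j<a with a ≤ᵇ j | ≤ᵇ-reflects-≤ a j
... | false | _       = refl
... | true  | ofʸ a≤j = contradiction a≤j (<⇒≱ j<a)

skipTwo-mono : skipTwo j Preserves _<_ ⟶ _<_
skipTwo-mono {j} {a} {b} a<b with a ≤? j | b ≤? j
... | yes a≤j | yes b≤j = subst₂ _<_ (sym (skipTwo-≤ a≤j)) (sym (skipTwo-≤ b≤j)) a<b
... | yes a≤j | no  b≰j = subst₂ _<_ (sym (skipTwo-≤ a≤j)) (sym (skipTwo-> (≰⇒> b≰j))) (<-≤-trans a<b (m≤n+m b 2))
... | no  a≰j | yes b≤j = contradiction (≤-trans (<⇒≤ a<b) b≤j) a≰j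
... | no  a≰j | no  b≰j = subst₂ _<_ (sym (skipTwo-> (≰⇒> a≰j))) (sym (skipTwo-> (≰⇒> b≰j))) (+-monoʳ-< 2 a<b)

ρ-length-skipTwo : ∀ j x → ρ-length (skipTwo j x) (2 + j ∷ 1 + j ∷ []) ≡or2+ 0
ρ-length-skipTwo j x with x ≤? j
... | yes x≤j = subst (λ u → ρ-length u (2 + j ∷ 1 + j ∷ []) ≡or2+ 0) (sym (skipTwo-≤ x≤j))
                  (inj₂ (trans (ρ-length-< _ (m≤n⇒m≤1+n (s≤s x≤j))) (cong suc (ρ-length-< [] (s≤s x≤j)))))
... | no  x≰j = subst (λ u → ρ-length u (2 + j ∷ 1 + j ∷ []) ≡or2+ 0) (sym (skipTwo-> (≰⇒> x≰j)))
                  (inj₁ (ρ-length-≮ _ (<⇒≯ (+-monoʳ-< 2 (≰⇒> x≰j)))))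

Jacobi-descentPair : ∀ j → Jacobi (2 + j ∷ 1 + j ∷ [])
Jacobi-descentPair j = Jacobi-∷ {x = 2 + j} {xs = 1 + j ∷ []} (ρ-length-≮ [] (<⇒≯ (n<1+n (1 + j)))) (2 ∣0 , tt)

module _ {n : ℕ} (A : List ℕ) {B : List ℕ} (τ↭ : IsPerm n (A ++ B)) where

  private
    w : List ℕ
    w = A ++ 2 + n ∷ 1 + n ∷ B

    A≤n : All (_≤ n) A
    A≤n = All.++⁻ˡ A (IsPerm-≤ τ↭)

  pos-addPair : i ∈ [1‥ n ] → pos i w ≡ skipTwo (length A) (pos i (A ++ B))
  pos-addPair {i} i∈ with i ∈? A
  ... | yes i∈A = begin
    pos i w                              ≡⟨ pos-++-∈ A _ i∈A ⟩
    pos i A                              ≡⟨ skipTwo-≤ (pos-≤-length A i∈A) ⟨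
    skipTwo (length A) (pos i A)         ≡⟨ cong (skipTwo (length A)) (pos-++-∈ A B i∈A) ⟨
    skipTwo (length A) (pos i (A ++ B))  ∎
  ... | no  i∉A = begin
    pos i w                                  ≡⟨ pos-++-∉ A _ i∉A ⟩
    length A + pos i (2 + n ∷ 1 + n ∷ B)     ≡⟨ cong (length A +_) (trans (pos-there (1 + n ∷ B) i≢2+n)
                                                                          (cong suc (pos-there B i≢1+n))) ⟩
    length A + (2 + pos i B)                 ≡⟨ trans (+-suc _ _) (cong suc (+-suc _ _)) ⟩
    2 + (length A + pos i B)                 ≡⟨ skipTwo-> (m<m+n (length A) (pos-∈-positive B i∈B)) ⟨
    skipTwo (length A) (length A + pos i B)  ≡⟨ cong (skipTwo (length A)) (pos-++-∉ A B i∉A) ⟨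
    skipTwo (length A) (pos i (A ++ B))      ∎
    where
    i≤n : i ≤ n
    i≤n = proj₂ (∈-[1‥]⁻ i∈)
    i≢1+n : i ≢ 1 + n
    i≢1+n = <⇒≢ (s≤s i≤n)
    i≢2+n : i ≢ 2 + n
    i≢2+n = <⇒≢ (m≤n⇒m≤1+n (s≤s i≤n))
    i∈B : i ∈ B
    i∈B with ∈-++⁻ A (IsPerm-∈ τ↭ (proj₁ (∈-[1‥]⁻ i∈)) i≤n)
    ... | inj₁ i∈A = contradiction i∈A i∉A
    ... | inj₂ i∈B = i∈B

  inverse-addPair : inverse (2 + n) w ≡ map (skipTwo (length A)) (inverse n (A ++ B)) ++ 2 + length A ∷ 1 + length A ∷ []
  inverse-addPair = begin
    inverse (2 + n) w                                  ≡⟨ inverse-suc-suc n w ⟩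
    inverse n w ++ pos (1 + n) w ∷ pos (2 + n) w ∷ []  ≡⟨ cong₂ _++_ inverse-below (cong₂ (λ u v → u ∷ v ∷ []) pos-1+n pos-2+n) ⟩
    map (skipTwo (length A)) (inverse n (A ++ B)) ++ 2 + length A ∷ 1 + length A ∷ [] ∎
    where
    inverse-below : inverse n w ≡ map (skipTwo (length A)) (inverse n (A ++ B))
    inverse-below = trans (map-cong-local (All.tabulate pos-addPair)) (map-∘ [1‥ n ])
    pos-1+n : pos (1 + n) w ≡ 2 + length A
    pos-1+n = begin
      pos (1 + n) w                               ≡⟨ pos-++-∉ A _ (All≤⇒∉ A≤n (n<1+n n)) ⟩
      length A + pos (1 + n) (2 + n ∷ 1 + n ∷ B)  ≡⟨ cong (length A +_) (trans (pos-there (1 + n ∷ B) (<⇒≢ (n<1+n (1 + n))))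
                                                                              (cong suc (pos-here {i = 1 + n} B refl))) ⟩
      length A + 2                                ≡⟨ +-comm (length A) 2 ⟩
      2 + length A                                ∎
    pos-2+n : pos (2 + n) w ≡ 1 + length A
    pos-2+n = begin
      pos (2 + n) w                               ≡⟨ pos-++-∉ A _ (All≤⇒∉ A≤n (m≤n⇒m≤1+n (n<1+n n))) ⟩
      length A + pos (2 + n) (2 + n ∷ 1 + n ∷ B)  ≡⟨ cong (length A +_) (pos-here {i = 2 + n} (1 + n ∷ B) refl) ⟩
      length A + 1                                ≡⟨ +-comm (length A) 1 ⟩
      1 + length A                                ∎

-- Decreasing prefixes

descRun : List ℕ → ℕ
descRun []           = 0
descRun (x ∷ [])     = 1
descRun (x ∷ y ∷ ys) = if y <ᵇ x then suc (descRun (y ∷ ys)) else 1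

descRun-> : ∀ {x y} ys → y < x → descRun (x ∷ y ∷ ys) ≡ suc (descRun (y ∷ ys))
descRun-> {x} {y} ys y<x with y <ᵇ x | <ᵇ-reflects-< y x
... | true  | _       = refl
... | false | ofⁿ y≮x = contradiction y<x y≮x

descRun-≯ : ∀ {x y} ys → y ≮ x → descRun (x ∷ y ∷ ys) ≡ 1
descRun-≯ {x} {y} ys y≮x with y <ᵇ x | <ᵇ-reflects-< y x
... | false | _       = refl
... | true  | ofʸ y<x = contradiction y<x y≮x

descRun-positive : ∀ x xs → 0 < descRun (x ∷ xs)
descRun-positive x []       = z<s
descRun-positive x (y ∷ ys) with y <ᵇ x
... | true  = z<s
... | false = z<s

descRun≤length : ∀ xs → descRun xs ≤ length xs
descRun≤length []       = z≤n
descRun≤length (x ∷ xs) = run≤ x xs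
  where
  run≤ : ∀ x ys → descRun (x ∷ ys) ≤ length (x ∷ ys)
  run≤ x []       = ≤-refl
  run≤ x (y ∷ ys) with y <ᵇ x
  ... | true  = s≤s (run≤ y ys)
  ... | false = s≤s z≤n

descRun-∷ : ∀ xs → All (_< x) xs → descRun (x ∷ xs) ≡ suc (descRun xs)
descRun-∷ []       []        = refl
descRun-∷ (y ∷ ys) (y<x ∷ _) = descRun-> ys y<x

descRun-++-above : ∀ x A → Linked _>_ (x ∷ A) → x < p → descRun (x ∷ A ++ p ∷ ys) ≡ length (x ∷ A)
descRun-++-above {ys = ys} x []      _           x<p = descRun-≯ ys (<⇒≯ x<p)
descRun-++-above {p} {ys}  x (y ∷ A) (y<x ∷ lnk) x<p =
  trans (descRun-> (A ++ p ∷ ys) y<x) (cong suc (descRun-++-above y A lnk (<-trans y<x x<p)))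

Linked-take-descRun : ∀ j xs → j ≤ descRun xs → Linked _>_ (take j xs)
Linked-take-descRun zero    xs       _   = []
Linked-take-descRun (suc j) []       _   = []
Linked-take-descRun (suc j) (x ∷ xs) j≤d = run j x xs j≤d
  where
  run : ∀ j x ys → suc j ≤ descRun (x ∷ ys) → Linked _>_ (x ∷ take j ys)
  run zero    x ys       _   = [-]
  run (suc j) x []       _   = [-]
  run (suc j) x (y ∷ ys) j≤d with y <ᵇ x | <ᵇ-reflects-< y x
  ... | true  | ofʸ y<x = y<x ∷ run j y ys (≤-pred j≤d)
  ... | false | _       = contradiction (≤-pred j≤d) λ ()

Linked⇒≤descRun : ∀ x A → Linked _>_ (x ∷ A) → length (x ∷ A) ≤ descRun (x ∷ A ++ B)
Linked⇒≤descRun {B} x []      _           = descRun-positive x B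
Linked⇒≤descRun {B} x (y ∷ A) (y<x ∷ lnk) =
  subst (length (x ∷ y ∷ A) ≤_) (sym (descRun-> (A ++ B) y<x)) (s≤s (Linked⇒≤descRun y A lnk))

Linked>⇒All< : Linked _>_ (x ∷ xs) → All (_< x) xs
Linked>⇒All< [-]         = []
Linked>⇒All< (y<x ∷ lnk) = Linked⇒All (λ y<x z<y → <-trans z<y y<x) y<x lnk

-- 123-avoidance

Avoids123-[] : Avoids123 []
Avoids123-[] (_ , _ , _ , () , _)

Avoids123-⊆ : xs ⊆ ys → Avoids123 ys → Avoids123 xs
Avoids123-⊆ xs⊆ys av (a , b , c , abc⊆xs , a<b , b<c) = av (a , b , c , ⊆-trans abc⊆xs xs⊆ys , a<b , b<c)

Avoids123-∷ : All (_≤ n) σ → Avoids123 σ → Avoids123 (suc n ∷ σ)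
Avoids123-∷ σ≤n av (a , b , c , (_ ∷ʳ abc⊆σ) , a<b , b<c) = av (a , b , c , abc⊆σ , a<b , b<c)
Avoids123-∷ σ≤n av (_ , b , c , (refl ∷ bc⊆σ) , a<b , b<c) = <⇒≱ a<b (m≤n⇒m≤1+n (All.lookup σ≤n (to∈ bc⊆σ)))

module _ {p q : ℕ} (q<p : q < p) where

  private
    ascent-below-pair : All (_< q) B → x ∷ y ∷ xs ⊆ p ∷ q ∷ B → x < y → x ∷ y ∷ xs ⊆ B
    ascent-below-pair {B = B} B<q (refl ∷ y⊆) p<y = contradiction p<y (<⇒≯ (below-p (to∈ y⊆)))
      where
      below-p : y ∈ q ∷ B → y < p
      below-p (here refl) = q<p
      below-p (there y∈B) = <-trans (All.lookup B<q y∈B) q<p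
    ascent-below-pair B<q (_ ∷ʳ (refl ∷ y⊆)) q<y = contradiction q<y (<⇒≯ (All.lookup B<q (to∈ y⊆)))
    ascent-below-pair B<q (_ ∷ʳ (_ ∷ʳ xy⊆B)) _   = xy⊆B

  Avoids123-addPair : Linked _>_ A → All (_< q) (A ++ B) → Avoids123 (A ++ B) → Avoids123 (A ++ p ∷ q ∷ B)
  Avoids123-addPair {[]}    _   B<q av (a , b , c , abc⊆ , a<b , b<c) =
    av (a , b , c , ascent-below-pair B<q abc⊆ a<b , a<b , b<c)
  Avoids123-addPair {x ∷ A} lnk (_ ∷ τ<q) av (a , b , c , (_ ∷ʳ abc⊆) , a<b , b<c) =
    Avoids123-addPair (Linked.tail lnk) τ<q (Avoids123-⊆ (x ∷ʳ ⊆-refl) av) (a , b , c , abc⊆ , a<b , b<c)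
  Avoids123-addPair {x ∷ A} {B} lnk (_ ∷ τ<q) av (_ , b , c , (refl ∷ bc⊆) , x<b , b<c) =
    av (x , b , c , refl ∷ ++⁺ˡ A bc⊆B , x<b , b<c)
    where
    b∉A : b ∉ A
    b∉A = All≤⇒∉ (All.map <⇒≤ (Linked>⇒All< lnk)) x<b
    bc⊆B : b ∷ c ∷ [] ⊆ B
    bc⊆B = ascent-below-pair (All.++⁻ʳ A τ<q) (∷⊆-++⁻ʳ A b∉A bc⊆) b<c

Avoids123⇒Linked : Unique (A ++ p ∷ B) → All (_< p) A → Avoids123 (A ++ p ∷ B) → Linked _>_ A
Avoids123⇒Linked {[]}                _                _         _  = []
Avoids123⇒Linked {x ∷ []}            _                _         _  = [-]
Avoids123⇒Linked {x ∷ y ∷ A} {p} {B} ((x≢y ∷ _) ∷ u) (_ ∷ A<p) av with y <? x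
... | yes y<x = y<x ∷ Avoids123⇒Linked u A<p (Avoids123-⊆ (x ∷ʳ ⊆-refl) av)
... | no  y≮x = contradiction (x , y , p , refl ∷ refl ∷ ++⁺ˡ A (refl ∷ minimum B) , x<y , All.head A<p) av
  where
  x<y : x < y
  x<y = ≤∧≢⇒< (≮⇒≥ y≮x) x≢y

-- Counted permutations of size n + 2

Counted-∷ : Counted n σ ⇔ Counted (suc n) (suc n ∷ σ)
Counted-∷ {n} {σ} = mk⇔ prepend remove
  where
  ρ-before-1 : ∀ x → ρ-length (suc x) [ 1 ] ≡or2+ 0
  ρ-before-1 x = inj₁ (ρ-length-≤ {x = suc x} (s≤s z≤n ∷ []))

  prepend : Counted n σ → Counted (suc n) (suc n ∷ σ)
  prepend (σ↭ , av , jσ , jσ⁻¹) =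
    Equivalence.to IsPerm-∷ σ↭ ,
    Avoids123-∷ σ≤n av ,
    Jacobi-∷ (ρ-length-≤ (All.map m≤n⇒m≤1+n σ≤n)) jσ ,
    subst Jacobi (sym (inverse-prepend n σ)) (Jacobi-relabel⁺ s<s [ 1 ] ρ-before-1 (2 ∣0 , tt) (inverse n σ) jσ⁻¹)
    where
    σ≤n : All (_≤ n) σ
    σ≤n = IsPerm-≤ σ↭

  remove : Counted (suc n) (suc n ∷ σ) → Counted n σ
  remove (w↭ , av , (_ , jσ) , jw⁻¹) =
    Equivalence.from IsPerm-∷ w↭ ,
    Avoids123-⊆ (_ ∷ʳ ⊆-refl) av ,
    jσ ,
    Jacobi-relabel⁻ s<s [ 1 ] ρ-before-1 (inverse n σ) (subst Jacobi (inverse-prepend n σ) jw⁻¹)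

Counted-addPair : ∀ A → Linked _>_ A → Counted n (A ++ B) ⇔ Counted (2 + n) (A ++ 2 + n ∷ 1 + n ∷ B)
Counted-addPair {n} {B} A lnk = mk⇔ insert remove
  where
  tail⁻¹ : List ℕ
  tail⁻¹ = 2 + length A ∷ 1 + length A ∷ []

  insert : Counted n (A ++ B) → Counted (2 + n) (A ++ 2 + n ∷ 1 + n ∷ B)
  insert (τ↭ , av , jτ , jτ⁻¹) =
    Equivalence.to (IsPerm-addPair A) τ↭ ,
    Avoids123-addPair (n<1+n (1 + n)) lnk τ<1+n av ,
    Jacobi-addPair (n<1+n (1 + n)) (All.++⁻ˡ A τ<1+n) (All.map <⇒≤ (All.++⁻ʳ A τ<1+n)) jτ ,
    subst Jacobi (sym (inverse-addPair A τ↭))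
      (Jacobi-relabel⁺ skipTwo-mono tail⁻¹ (ρ-length-skipTwo (length A)) (Jacobi-descentPair (length A))
                       (inverse n (A ++ B)) jτ⁻¹)
    where
    τ<1+n : All (_< 1 + n) (A ++ B)
    τ<1+n = All.map s≤s (IsPerm-≤ τ↭)

  remove : Counted (2 + n) (A ++ 2 + n ∷ 1 + n ∷ B) → Counted n (A ++ B)
  remove (w↭ , av , jw , jw⁻¹) =
    τ↭ ,
    Avoids123-⊆ (++⁺ ⊆-refl (_ ∷ʳ (_ ∷ʳ ⊆-refl))) av ,
    Jacobi-dropPair (n<1+n (1 + n)) (All.++⁻ˡ A (All.map s≤s (IsPerm-≤ τ↭))) jw ,
    Jacobi-relabel⁻ skipTwo-mono tail⁻¹ (ρ-length-skipTwo (length A)) (inverse n (A ++ B))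
                    (subst Jacobi (inverse-addPair A τ↭) jw⁻¹)
    where
    τ↭ : IsPerm n (A ++ B)
    τ↭ = Equivalence.from (IsPerm-addPair A) w↭

Counted-1+n-after-2+n : ∀ A → Counted (2 + n) (A ++ 2 + n ∷ B) → 1 + n ∈ B
Counted-1+n-after-2+n {n} {B} A (w↭ , _ , _ , jw⁻¹) with ∈-++⁻ A (IsPerm-∈ w↭ z<s (n≤1+n (1 + n)))
... | inj₂ (there 1+n∈B)  = 1+n∈B
... | inj₂ (here 1+n≡2+n) = contradiction 1+n≡2+n (<⇒≢ (n<1+n (1 + n)))
... | inj₁ 1+n∈A          =
  contradiction (subst₂ _<_ (sym pos-1+n) (sym pos-2+n) (s≤s (pos-≤-length A 1+n∈A))) (Jacobi-inverse-last-two n w jw⁻¹)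
  where
  w = A ++ 2 + n ∷ B
  pos-1+n : pos (1 + n) w ≡ pos (1 + n) A
  pos-1+n = pos-++-∈ A _ 1+n∈A
  pos-2+n : pos (2 + n) w ≡ 1 + length A
  pos-2+n = trans (pos-++-∉ A _ (Unique-∉ˡ A (IsPerm⇒Unique w↭)))
                  (trans (cong (length A +_) (pos-here {i = 2 + n} B refl)) (+-comm (length A) 1))

-- The letter y after 2 + n exceeds some letter z before it, so y ≢ 1 + n would give the 123-pattern z y (1 + n).
Counted-pair-adjacent : ∀ x A → Counted (2 + n) (x ∷ A ++ 2 + n ∷ B) → ∃[ C ] B ≡ 1 + n ∷ C
Counted-pair-adjacent {n} {[]}    x A c = contradiction (Counted-1+n-after-2+n (x ∷ A) c) λ ()
Counted-pair-adjacent {n} {y ∷ C} x A c@(w↭ , av , jw , _) with y ≟ 1 + n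
... | yes refl  = C , refl
... | no  y≢1+n = contradiction (z , y , 1 + n , z∷y∷1+n⊆w , z<y , y<1+n) av
  where
  z-below-y = Jacobi-peak-ascent x A (IsPerm-before-max (x ∷ A) w↭) jw
  z = proj₁ z-below-y
  z<y = proj₂ (proj₂ z-below-y)
  y<2+n : y < 2 + n
  y<2+n = ≤∧≢⇒< (proj₂ (IsPerm-bounds w↭ (∈-++⁺ʳ (x ∷ A) (there (here refl)))))
                (λ y≡2+n → Unique-∉ʳ (x ∷ A) (IsPerm⇒Unique w↭) (here (sym y≡2+n)))
  y<1+n : y < 1 + n
  y<1+n = ≤∧≢⇒< (≤-pred y<2+n) y≢1+n
  z∷y∷1+n⊆w : z ∷ y ∷ 1 + n ∷ [] ⊆ x ∷ A ++ 2 + n ∷ y ∷ C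
  z∷y∷1+n⊆w = ++⁺ (from∈ (proj₁ (proj₂ z-below-y)))
                  (_ ∷ʳ (refl ∷ from∈ (Any.tail (y≢1+n ∘ sym) (Counted-1+n-after-2+n (x ∷ A) c))))

-- Enumeration

insertPair : ℕ → ℕ → List ℕ → List ℕ
insertPair n j τ = take j τ ++ 2 + n ∷ 1 + n ∷ drop j τ

insertPair-++ : ∀ A → insertPair n (length A) (A ++ B) ≡ A ++ 2 + n ∷ 1 + n ∷ B
insertPair-++ []      = refl
insertPair-++ (a ∷ A) = cong (a ∷_) (insertPair-++ A)

insertPair-injective : ∀ {τ υ} → All (_≤ n) τ → All (_≤ n) υ → i ≤ length τ → j ≤ length υ →
                       insertPair n i τ ≡ insertPair n j υ → i ≡ j × τ ≡ υ
insertPair-injective {n} {i} {j} {τ} {υ} τ≤n υ≤n i≤ j≤ e = i≡j , τ≡υ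
  where
  2+n∉ : ∀ k {xs} → All (_≤ n) xs → 2 + n ∉ take k xs
  2+n∉ k xs≤n = All≤⇒∉ (All.take⁺ k xs≤n) (m≤n⇒m≤1+n (n<1+n n))
  split≡ : take i τ ≡ take j υ × 1 + n ∷ drop i τ ≡ 1 + n ∷ drop j υ
  split≡ = ++-∷-cancel-∉ (take i τ) (take j υ) (2+n∉ i τ≤n) (2+n∉ j υ≤n) e
  i≡j : i ≡ j
  i≡j = trans (sym (length-take-≤ i τ i≤)) (trans (cong length (proj₁ split≡)) (length-take-≤ j υ j≤))
  τ≡υ : τ ≡ υ
  τ≡υ = trans (sym (take++drop≡id i τ))
              (trans (cong₂ _++_ (proj₁ split≡) (∷-injectiveʳ (proj₂ split≡))) (take++drop≡id j υ))

insertions : ℕ → List ℕ → List (List ℕ)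
insertions n τ = map (λ j → insertPair n j τ) [1‥ descRun τ ]

enumCounted : ℕ → List (List ℕ)
enumCounted zero          = [ [] ]
enumCounted (suc zero)    = [ [ 1 ] ]
enumCounted (suc (suc n)) = map (2 + n ∷_) (enumCounted (suc n)) ++ concatMap (insertions n) (enumCounted n)

enumCounted-sound : ∀ n → σ ∈ enumCounted n → Counted n σ
enumCounted-sound zero          (here refl) = ↭-refl , Avoids123-[] , tt , tt
enumCounted-sound (suc zero)    (here refl) = Equivalence.to Counted-∷ (enumCounted-sound zero (here refl))
enumCounted-sound (suc (suc n)) σ∈ =
  step (enumCounted-sound (suc n)) (enumCounted-sound n) (∈-++⁻ (map (2 + n ∷_) (enumCounted (suc n))) σ∈)
  where
  step : (∀ {ρ} → ρ ∈ enumCounted (suc n) → Counted (suc n) ρ) → (∀ {τ} → τ ∈ enumCounted n → Counted n τ) →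
         σ ∈ map (2 + n ∷_) (enumCounted (suc n)) ⊎ σ ∈ concatMap (insertions n) (enumCounted n) → Counted (2 + n) σ
  step sound₁ _ (inj₁ σ∈top) with map∷⁻ σ∈top
  ... | _ , ρ∈ , refl = Equivalence.to Counted-∷ (sound₁ ρ∈)
  step _ sound₀ (inj₂ σ∈ins) with find (∈-concatMap⁻ (insertions n) σ∈ins)
  ... | τ , τ∈ , σ∈τ with ∈-map⁻ (λ j → insertPair n j τ) σ∈τ
  ...   | j , j∈ , refl =
    Equivalence.to (Counted-addPair (take j τ) (Linked-take-descRun j τ (proj₂ (∈-[1‥]⁻ j∈))))
      (subst (Counted n) (sym (take++drop≡id j τ)) (sound₀ τ∈))

enumCounted-≤ : ∀ n {τ} → τ ∈ enumCounted n → All (_≤ n) τ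
enumCounted-≤ n τ∈ = IsPerm-≤ (proj₁ (enumCounted-sound n τ∈))

enumCounted-complete : ∀ n → Counted n σ → σ ∈ enumCounted n
enumCounted-complete zero          (σ↭ , _) rewrite ↭-empty-inv σ↭     = here refl
enumCounted-complete (suc zero)    (σ↭ , _) rewrite ↭-singleton-inv σ↭ = here refl
enumCounted-complete (suc (suc n)) c = step (enumCounted-complete (suc n)) (enumCounted-complete n) c
  where
  step : (∀ {ρ} → Counted (suc n) ρ → ρ ∈ enumCounted (suc n)) → (∀ {τ} → Counted n τ → τ ∈ enumCounted n) →
         Counted (2 + n) σ → σ ∈ enumCounted (2 + n)
  step complete₁ complete₀ c@(σ↭ , av , _) with ∈-∃++ (IsPerm-∈ σ↭ z<s ≤-refl)
  ... | [] , B , refl = ∈-++⁺ˡ (∈-map⁺ (2 + n ∷_) (complete₁ (Equivalence.from Counted-∷ c)))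
  ... | x ∷ A , B , refl with Counted-pair-adjacent x A c
  ...   | C , refl = ∈-++⁺ʳ _ (∈-concatMap⁺ (insertions n) (lose τ∈ σ∈insertions))
    where
    τ = x ∷ A ++ C
    lnk : Linked _>_ (x ∷ A)
    lnk = Avoids123⇒Linked (IsPerm⇒Unique σ↭) (IsPerm-before-max (x ∷ A) σ↭) av
    τ∈ : τ ∈ enumCounted n
    τ∈ = complete₀ (Equivalence.from (Counted-addPair (x ∷ A) lnk) c)
    σ∈insertions : x ∷ A ++ 2 + n ∷ 1 + n ∷ C ∈ insertions n τ
    σ∈insertions = subst (_∈ insertions n τ) (insertPair-++ (x ∷ A))
                         (∈-map⁺ (λ j → insertPair n j τ) (∈-[1‥]⁺ z<s (Linked⇒≤descRun x A lnk)))

Unique-enumCounted : ∀ n → Unique (enumCounted n)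
Unique-enumCounted zero          = [] ∷ []
Unique-enumCounted (suc zero)    = [] ∷ []
Unique-enumCounted (suc (suc n)) =
  Unique.++⁺ (Unique.map⁺ ∷-injectiveʳ (Unique-enumCounted (suc n)))
             (Unique-concatMap⁺ (insertions n) (Unique-enumCounted n) insertions-unique insertions-shared)
             top-disjoint-insertions
  where
  ≤length : ∀ τ → j ∈ [1‥ descRun τ ] → j ≤ length τ
  ≤length τ j∈ = ≤-trans (proj₂ (∈-[1‥]⁻ j∈)) (descRun≤length τ)

  insertions-unique : ∀ {τ} → τ ∈ enumCounted n → Unique (insertions n τ)
  insertions-unique {τ} τ∈ = Unique-map⁺-∈ (λ i∈ j∈ e → proj₁ (insertPair-injective τ≤n τ≤n (≤length τ i∈) (≤length τ j∈) e))
                                           (Unique-[1‥] (descRun τ))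
    where
    τ≤n = enumCounted-≤ n τ∈

  insertions-shared : ∀ {τ υ v} → τ ∈ enumCounted n → υ ∈ enumCounted n → v ∈ insertions n τ → v ∈ insertions n υ → τ ≡ υ
  insertions-shared {τ} {υ} τ∈ υ∈ v∈τ v∈υ with ∈-map⁻ (λ j → insertPair n j τ) v∈τ | ∈-map⁻ (λ j → insertPair n j υ) v∈υ
  ... | i , i∈ , refl | j , j∈ , e =
    proj₂ (insertPair-injective (enumCounted-≤ n τ∈) (enumCounted-≤ n υ∈) (≤length τ i∈) (≤length υ j∈) e)

  top-disjoint-insertions : Disjoint (map (2 + n ∷_) (enumCounted (suc n))) (concatMap (insertions n) (enumCounted n))
  top-disjoint-insertions (v∈top , v∈ins) with map∷⁻ v∈top | find (∈-concatMap⁻ (insertions n) {xs = enumCounted n} v∈ins)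
  ... | _ , _ , refl | τ , τ∈ , v∈τ with ∈-map⁻ (λ j → insertPair n j τ) v∈τ
  ...   | j , j∈ , e = top-not-first τ j (enumCounted-≤ n τ∈) (∈-[1‥]⁻ j∈) e
    where
    top-not-first : ∀ {ρ} τ j → All (_≤ n) τ → 0 < j × j ≤ descRun τ → 2 + n ∷ ρ ≡ insertPair n j τ → ⊥
    top-not-first []      _       _         (0<j , j≤0) _ = <⇒≱ 0<j j≤0
    top-not-first (x ∷ τ) (suc j) (x≤n ∷ _) _           e =
      <⇒≱ (m≤n⇒m≤1+n (n<1+n n)) (subst (_≤ n) (sym (∷-injectiveˡ e)) x≤n)

-- Counting

descRun-insertPair : ∀ τ → All (_≤ n) τ → j ∈ [1‥ descRun τ ] → descRun (insertPair n j τ) ≡ j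
descRun-insertPair []      _ ()
descRun-insertPair {n} {j} (x ∷ τ) (x≤n ∷ _) j∈ with ∈-[1‥]⁻ j∈
... | z<s {j₀} , j≤d = begin
  descRun (x ∷ take j₀ τ ++ 2 + n ∷ 1 + n ∷ drop j₀ τ)
    ≡⟨ descRun-++-above x (take j₀ τ) (Linked-take-descRun j (x ∷ τ) j≤d) (s≤s (m≤n⇒m≤1+n x≤n)) ⟩
  suc (length (take j₀ τ))
    ≡⟨ cong suc (length-take-≤ j₀ τ (≤-pred (≤-trans j≤d (descRun≤length (x ∷ τ))))) ⟩
  j ∎

runLengths : ℕ → List ℕ
runLengths zero          = [ 0 ]
runLengths (suc zero)    = [ 1 ]
runLengths (suc (suc n)) = map suc (runLengths (suc n)) ++ concatMap [1‥_] (runLengths n)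

map-descRun-enumCounted : ∀ n → map descRun (enumCounted n) ≡ runLengths n
map-descRun-enumCounted zero          = refl
map-descRun-enumCounted (suc zero)    = refl
map-descRun-enumCounted (suc (suc n)) = begin
  map descRun (map (2 + n ∷_) L₁ ++ concatMap (insertions n) L₀)
    ≡⟨ map-++ descRun (map (2 + n ∷_) L₁) _ ⟩
  map descRun (map (2 + n ∷_) L₁) ++ map descRun (concatMap (insertions n) L₀)
    ≡⟨ cong₂ _++_ top-runs insertion-runs ⟩
  map suc (map descRun L₁) ++ concatMap [1‥_] (map descRun L₀)
    ≡⟨ cong₂ (λ r₁ r₀ → map suc r₁ ++ concatMap [1‥_] r₀) (map-descRun-enumCounted (suc n)) (map-descRun-enumCounted n) ⟩
  runLengths (2 + n) ∎
  where
  L₁ = enumCounted (suc n)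
  L₀ = enumCounted n

  top-runs : map descRun (map (2 + n ∷_) L₁) ≡ map suc (map descRun L₁)
  top-runs = begin
    map descRun (map (2 + n ∷_) L₁)  ≡⟨ map-∘ L₁ ⟨
    map (descRun ∘ (2 + n ∷_)) L₁    ≡⟨ map-cong-local (All.tabulate λ ρ∈ →
                                          descRun-∷ _ (All.map s≤s (enumCounted-≤ (suc n) ρ∈))) ⟩
    map (suc ∘ descRun) L₁           ≡⟨ map-∘ L₁ ⟩
    map suc (map descRun L₁)         ∎

  insertion-runs : map descRun (concatMap (insertions n) L₀) ≡ concatMap [1‥_] (map descRun L₀)
  insertion-runs = begin
    map descRun (concatMap (insertions n) L₀)  ≡⟨ map-concatMap descRun (insertions n) L₀ ⟩
    concatMap (map descRun ∘ insertions n) L₀  ≡⟨ cong concat (map-cong-local (All.tabulate runs-of-insertions)) ⟩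
    concatMap ([1‥_] ∘ descRun) L₀             ≡⟨ concatMap-map [1‥_] descRun L₀ ⟨
    concatMap [1‥_] (map descRun L₀)           ∎
    where
    runs-of-insertions : ∀ {τ} → τ ∈ L₀ → map descRun (insertions n τ) ≡ [1‥ descRun τ ]
    runs-of-insertions {τ} τ∈ =
      trans (sym (map-∘ [1‥ descRun τ ])) (map-id-local (All.tabulate (descRun-insertPair τ (enumCounted-≤ n τ∈))))

runCount : ℕ → ℕ
runCount n = length (runLengths n)

length-enumCounted : ∀ n → length (enumCounted n) ≡ runCount n
length-enumCounted n = trans (sym (length-map descRun (enumCounted n))) (cong length (map-descRun-enumCounted n))

runSum : (ℕ → ℕ) → ℕ → ℕ
runSum f n = sum (map f (runLengths n))

prefixSum : (ℕ → ℕ) → ℕ → ℕ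
prefixSum f x = sum (map f [1‥ x ])

runConv : (ℕ → ℕ) → ℕ → ℕ
runConv u m = sumBelow m (λ i → runCount (m ∸ suc i) * u (suc i))

prefixSum-suc : ∀ f x → prefixSum f (suc x) ≡ f 1 + prefixSum (f ∘ suc) x
prefixSum-suc f x = trans (sum-map-[1‥] f (suc x)) (cong (f 1 +_) (sym (sum-map-[1‥] (f ∘ suc) x)))

runSum-cong : ∀ {f g} n → (∀ x → f x ≡ g x) → runSum f n ≡ runSum g n
runSum-cong n f≗g = cong sum (map-cong f≗g (runLengths n))

runSum-+ : ∀ f g n → runSum (λ x → f x + g x) n ≡ runSum f n + runSum g n
runSum-+ f g n = sum-map-+ f g (runLengths n)

runSum-const : ∀ c n → runSum (λ _ → c) n ≡ c * runCount n
runSum-const c n = sum-map-const c (runLengths n)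

runSum-suc-suc : ∀ f n → runSum f (2 + n) ≡ runSum (f ∘ suc) (1 + n) + runSum (prefixSum f) n
runSum-suc-suc f n = trans (sum-map-++ f (map suc (runLengths (suc n))) _)
  (cong₂ _+_ (cong sum (sym (map-∘ (runLengths (suc n))))) (sum-map-concatMap f [1‥_] (runLengths n)))

runConv-runSum-suc-suc : ∀ f m → runConv (runSum f) (2 + m) ≡
  (f 1 * runCount (1 + m) + runConv (runSum (f ∘ suc)) (1 + m)) + runConv (runSum (prefixSum f)) m
runConv-runSum-suc-suc f m = begin
  runCount (1 + m) * (f 1 + 0) + sumBelow (1 + m) (λ i → runCount (m ∸ i) * runSum f (2 + i))
    ≡⟨ cong₂ _+_ (trans (cong (runCount (1 + m) *_) (+-identityʳ (f 1))) (*-comm (runCount (1 + m)) (f 1))) split ⟩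
  f 1 * runCount (1 + m) + (runConv (runSum (f ∘ suc)) (1 + m) + (runCount m * 0 + runConv (runSum (prefixSum f)) m))
    ≡⟨ cong (λ z → f 1 * runCount (1 + m) + (runConv (runSum (f ∘ suc)) (1 + m) + (z + runConv (runSum (prefixSum f)) m)))
            (*-zeroʳ (runCount m)) ⟩
  f 1 * runCount (1 + m) + (runConv (runSum (f ∘ suc)) (1 + m) + runConv (runSum (prefixSum f)) m)
    ≡⟨ +-assoc (f 1 * runCount (1 + m)) _ _ ⟨
  (f 1 * runCount (1 + m) + runConv (runSum (f ∘ suc)) (1 + m)) + runConv (runSum (prefixSum f)) m ∎
  where
  split : sumBelow (1 + m) (λ i → runCount (m ∸ i) * runSum f (2 + i)) ≡
          sumBelow (1 + m) (λ i → runCount (m ∸ i) * runSum (f ∘ suc) (1 + i)) +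
          sumBelow (1 + m) (λ i → runCount (m ∸ i) * runSum (prefixSum f) i)
  split = trans (sumBelow-cong (1 + m) λ {i} _ →
                   trans (cong (runCount (m ∸ i) *_) (runSum-suc-suc f i))
                         (*-distribˡ-+ (runCount (m ∸ i)) (runSum (f ∘ suc) (1 + i)) (runSum (prefixSum f) i)))
                (sumBelow-+ (1 + m) (λ i → runCount (m ∸ i) * runSum (f ∘ suc) (1 + i))
                                    (λ i → runCount (m ∸ i) * runSum (prefixSum f) i))

runSum-prefixSum : ∀ m f → runSum (prefixSum f) m ≡ runConv (runSum f) m
runSum-prefixSum zero          f = refl
runSum-prefixSum (suc zero)    f = cong (_+ 0) (sym (*-identityˡ (f 1 + 0)))
runSum-prefixSum (suc (suc m)) f = begin
  runSum (prefixSum f) (2 + m)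
    ≡⟨ runSum-suc-suc (prefixSum f) m ⟩
  runSum (prefixSum f ∘ suc) (1 + m) + runSum (prefixSum (prefixSum f)) m
    ≡⟨ cong (_+ runSum (prefixSum (prefixSum f)) m) (trans (runSum-cong (1 + m) (prefixSum-suc f)) (runSum-+ _ _ (1 + m))) ⟩
  (runSum (λ _ → f 1) (1 + m) + runSum (prefixSum (f ∘ suc)) (1 + m)) + runSum (prefixSum (prefixSum f)) m
    ≡⟨ cong₂ (λ a b → (a + b) + runSum (prefixSum (prefixSum f)) m)
             (runSum-const (f 1) (1 + m)) (runSum-prefixSum (suc m) (f ∘ suc)) ⟩
  (f 1 * runCount (1 + m) + runConv (runSum (f ∘ suc)) (1 + m)) + runSum (prefixSum (prefixSum f)) m
    ≡⟨ cong (f 1 * runCount (1 + m) + runConv (runSum (f ∘ suc)) (1 + m) +_) (runSum-prefixSum m (prefixSum f)) ⟩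
  (f 1 * runCount (1 + m) + runConv (runSum (f ∘ suc)) (1 + m)) + runConv (runSum (prefixSum f)) m
    ≡⟨ runConv-runSum-suc-suc f m ⟨
  runConv (runSum f) (2 + m) ∎

runCount-suc-suc : ∀ m → runCount (2 + m) ≡ runCount (1 + m) + runConv runCount m
runCount-suc-suc m = begin
  runCount (2 + m)                               ≡⟨ runCount≡runSum (2 + m) ⟩
  runSum one (2 + m)                             ≡⟨ runSum-suc-suc one m ⟩
  runSum one (1 + m) + runSum (prefixSum one) m  ≡⟨ cong₂ _+_ (sym (runCount≡runSum (1 + m))) (runSum-prefixSum m one) ⟩
  runCount (1 + m) + runConv (runSum one) m      ≡⟨ cong (runCount (1 + m) +_) (sumBelow-cong m λ {i} _ →
                                                      cong (runCount (m ∸ suc i) *_) (sym (runCount≡runSum (suc i)))) ⟩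
  runCount (1 + m) + runConv runCount m          ∎
  where
  one : ℕ → ℕ
  one _ = 1
  runCount≡runSum : ∀ n → runCount n ≡ runSum one n
  runCount≡runSum n = sym (trans (runSum-const 1 n) (*-identityˡ (runCount n)))

runCount≡s : (s : ℕ → ℕ) → s zero ≡ 1 → (∀ n → s (suc n) ≡ s n + convSum s n) → ∀ n → runCount n ≡ s n
runCount≡s s s0 s-suc = <-rec _ step
  where
  step : ∀ n → (∀ {m} → m < n → runCount m ≡ s m) → runCount n ≡ s n
  step zero          _  = sym s0
  step (suc zero)    _  = sym (trans (s-suc 0) (cong (_+ 0) s0))
  step (suc (suc m)) ih = begin
    runCount (2 + m)                       ≡⟨ runCount-suc-suc m ⟩
    runCount (1 + m) + runConv runCount m  ≡⟨ cong₂ _+_ (ih (n<1+n (1 + m))) conv≡ ⟩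
    s (1 + m) + convSum s (1 + m)          ≡⟨ s-suc (1 + m) ⟨
    s (2 + m)                              ∎
    where
    conv≡ : runConv runCount m ≡ convSum s (1 + m)
    conv≡ = begin
      runConv runCount m                            ≡⟨ sumBelow-cong m (λ {i} i<m →
                                                         trans (cong₂ _*_ (ih (s≤s (m≤n⇒m≤1+n (m∸n≤m m (suc i)))))
                                                                          (ih (s<s (m<n⇒m<1+n i<m))))
                                                               (*-comm (s (m ∸ suc i)) (s (suc i)))) ⟩
      sumBelow m (λ i → s (suc i) * s (m ∸ suc i))  ≡⟨ sum-map-[1‥] (λ k → s k * s (m ∸ k)) m ⟨
      convSum s (1 + m)                             ∎

theorem6p8 : (s : ℕ → ℕ) → s zero ≡ 1 → (∀ n → s (suc n) ≡ s n + convSum s n) →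
    ∀ n → ∃[ L ] (Unique L × (∀ w → (w ∈ L) ⇔ Counted n w) × length L ≡ s n)
theorem6p8 s s0 s-suc n =
  enumCounted n ,
  Unique-enumCounted n ,
  (λ w → mk⇔ (enumCounted-sound n) (enumCounted-complete n)) ,
  trans (length-enumCounted n) (runCount≡s s s0 s-suc n)
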